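{- Let $\mathcal{P}$ be a finite chiral $n$-polytope, and let $\mathcal{Q}$ be a finite chiral $n$-polytope such that $\Gamma^+(\mathcal{Q})$ is simple. If $X(\mathcal{P})$ is not isomorphic to $\Gamma^+(\mathcal{Q})$, then $\mathcal{P}\diamond\mathcal{Q}$ is chiral.
   Context: All polytopes are abstract polytopes. A polytope is chiral if its automorphism group has two orbits on flags, adjacent flags lying in distinct orbits; then $\Gamma^+(\mathcal{P})$ is its automorphism group, generated by standard rotations $\sigma_1,\dots,\sigma_{n-1}$ relative to a base flag. Let $W^+=\langle \sigma_1,\dots,\sigma_{n-1}\mid (\sigma_i\cdots\sigma_j)^2=1,\ 1\le i<j\le n-1\rangle$; then $\Gamma^+(\mathcal{P})=W^+/M$ for a normal subgroup $M$, generators corresponding. Let $w\mapsto\overline{w}$ be the automorphism of $W^+$ with $\sigma_1\mapsto\sigma_1^{ -1}$, $\sigma_2\mapsto\sigma_1^2\sigma_2$, $\sigma_j\mapsto\sigma_j$ ($j\ge3$), and $\overline M$ the image of $M$. Mix: if $\Gamma^+(\mathcal{P})=W^+/M$ and $\Gamma^+(\mathcal{Q})=W^+/K$, the mix $\mathcal{P}\diamond\mathcal{Q}$ is the (flag-connected pre-)polytope whose rotation group is the subgroup of $\Gamma^+(\mathcal{P})\times\Gamma^+(\mathcal{Q})$ generated by $(\sigma_i,\sigma_i')$, isomorphic to $W^+/N$ with $N=M\cap K$; it is chiral if $\overline N\ne N$ and directly regular otherwise. Chirality group: $X(\mathcal{P})=M\overline{M}/M$, the kernel of the natural epimorphism $W^+/M\to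 W^+/(M\overline M)$ (isomorphic to the kernel of the natural epimorphism $W^+/(M\cap\overline M)\to W^+/M$). -}

module Defs where

open import Level using (0ℓ)
open import Data.Bool using (Bool; true; false; not; if_then_else_; _∧_)
open import Data.Nat using (ℕ; _∸_; _<_; _≤ᵇ_; _<ᵇ_)
open import Data.Fin using (Fin; zero; suc; toℕ)
open import Data.Fin.Subset using (Subset; _∈_; _∩_)
open import Data.List using (List; []; _∷_; _++_; map; reverse; concatMap; filterᵇ; allFin)
open import Data.Product using (Σ; ∃; ∃-syntax; _×_; _,_)
open import Data.Sum using (_⊎_)
open import Relation.Nullary using (¬_)
open import Algebra.Bundles.Raw using (RawGroup)
open import Algebra.Morphism.Structures using (module GroupMorphisms)

-- The free group on the generators σ₁,…,σ_{n-1} of a rank-n polytope.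
-- Generator σ_{k+1} is represented by k : Fin (n ∸ 1).
-- A letter (false , k) is σ_{k+1}, (true , k) is σ_{k+1}⁻¹.

Gen : ℕ → Set
Gen n = Fin (n ∸ 1)

record Letter (n : ℕ) : Set where
  constructor ⟨_,_⟩
  field
    inverted : Bool
    gen      : Gen n

Word : ℕ → Set
Word n = List (Letter n)

flipL : ∀ {n} → Letter n → Letter n
flipL ⟨ b , k ⟩ = ⟨ not b , k ⟩

inv : ∀ {n} → Word n → Word n
inv w = reverse (map flipL w)

-- σ_{i+1} σ_{i+2} ⋯ σ_{j+1} (generator indices i ≤ k ≤ j)
segment : ∀ {n} → Gen n → Gen n → Word n
segment {n} i j =
  map (λ k → ⟨ false , k ⟩)
      (filterᵇ (λ k → (toℕ i ≤ᵇ toℕ k) ∧ (toℕ k ≤ᵇ toℕ j)) (allFin (n ∸ 1)))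

-- defining relators of W⁺ : (σ_i ⋯ σ_j)² for 1 ≤ i < j ≤ n-1
relator : ∀ {n} → Gen n → Gen n → Word n
relator i j = segment i j ++ segment i j

-- The automorphism w ↦ w̄ : σ₁ ↦ σ₁⁻¹, σ₂ ↦ σ₁²σ₂, σⱼ ↦ σⱼ (j ≥ 3),
-- computed on words.

barLetter′ : ∀ {m} → Bool → Fin m → List (Bool × Fin m)
barLetter′ b zero = (not b , zero) ∷ []
barLetter′ false (suc zero) = (false , zero) ∷ (false , zero) ∷ (false , suc zero) ∷ []
barLetter′ true (suc zero) = (true , suc zero) ∷ (true , zero) ∷ (true , zero) ∷ []
barLetter′ b (suc (suc k)) = (b , suc (suc k)) ∷ []

barLetter : ∀ {n} → Letter n → Word n
barLetter ⟨ b , k ⟩ = map (λ { (b′ , k′) → ⟨ b′ , k′ ⟩ }) (barLetter′ b k)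

bar : ∀ {n} → Word n → Word n
bar = concatMap barLetter

-- Normal subgroups M of W⁺, represented (via W⁺ = F / ⟨⟨relators⟩⟩) as
-- the full preimage in the free group F, i.e. a set of words closed under
-- free (in)equivalence, a normal subgroup of F, containing the relators.

record IsRotationKernel (n : ℕ) (M : Word n → Set) : Set where
  field
    reduce   : ∀ u x v → M (u ++ x ∷ flipL x ∷ v) → M (u ++ v)
    unreduce : ∀ u x v → M (u ++ v) → M (u ++ x ∷ flipL x ∷ v)
    ε-mem    : M []
    ∙-closed : ∀ u v → M u → M v → M (u ++ v)
    ⁻¹-closed : ∀ u → M u → M (inv u)
    normal   : ∀ w u → M u → M (w ++ u ++ inv w)
    relators : ∀ (i j : Gen n) → toℕ i < toℕ j → M (relator i j)

-- M̄ = image of M under the bar automorphism (bar is an involution,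
-- so w ∈ M̄ iff w̄ ∈ M).
barSet : ∀ {n} → (Word n → Set) → Word n → Set
barSet M w = M (bar w)

SameSet : ∀ {n} → (Word n → Set) → (Word n → Set) → Set
SameSet A B = ∀ w → (A w → B w) × (B w → A w)

Γ⁺ : ∀ n → (Word n → Set) → RawGroup 0ℓ 0ℓ
Γ⁺ n M = record
  { Carrier = Word n
  ; _≈_ = λ u v → M (inv u ++ v)
  ; _∙_ = _++_
  ; ε = []
  ; _⁻¹ = inv
  }

-- The chirality group X(P) = M M̄ / M, as the subgroup of W⁺/M generated
-- by (the images of) M ∪ M̄ (which equals M M̄ since M is normal).
-- An element is a formal product of such generators (with exponent ±1).
Piece : ∀ n → (Word n → Set) → Set
Piece n M = Bool × Σ (Word n) (λ w → M w ⊎ M (bar w))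

evalPieces : ∀ {n M} → List (Piece n M) → Word n
evalPieces [] = []
evalPieces ((b , w , _) ∷ ps) = (if b then inv w else w) ++ evalPieces ps

invPieces : ∀ {n M} → List (Piece n M) → List (Piece n M)
invPieces ps = reverse (map (λ { (b , x) → (not b , x) }) ps)

X : ∀ n → (Word n → Set) → RawGroup 0ℓ 0ℓ
X n M = record
  { Carrier = List (Piece n M)
  ; _≈_ = λ p q → M (inv (evalPieces p) ++ evalPieces q)
  ; _∙_ = _++_
  ; ε = []
  ; _⁻¹ = invPieces
  }

Isomorphic : RawGroup 0ℓ 0ℓ → RawGroup 0ℓ 0ℓ → Set
Isomorphic G H =
  Σ (RawGroup.Carrier G → RawGroup.Carrier H) (GroupMorphisms.IsGroupIsomorphism G H)

IsFinite : RawGroup 0ℓ 0ℓ → Set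
IsFinite G = ∃[ k ] Σ (Fin k → Carrier) (λ f → ∀ g → ∃[ i ] f i ≈ g)
  where open RawGroup G

IsNormalSubgroup : (G : RawGroup 0ℓ 0ℓ) → (RawGroup.Carrier G → Set) → Set
IsNormalSubgroup G N =
    (∀ {g h} → g ≈ h → N g → N h)
  × N ε
  × (∀ g h → N g → N h → N (g ∙ h))
  × (∀ g → N g → N (g ⁻¹))
  × (∀ g h → N h → N ((g ∙ h) ∙ (g ⁻¹)))
  where open RawGroup G

IsSimple : RawGroup 0ℓ 0ℓ → Set₁
IsSimple G =
    (∃[ g ] ¬ (g ≈ ε))
  × (∀ N → IsNormalSubgroup G N → (∀ g → N g → g ≈ ε) ⊎ (∀ g → N g))
  where open RawGroup G

-- Intersection condition for rotation groups (Schulte–Weiss):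
-- τ_{i,j} = σ_{i+1} ⋯ σ_j for 0 ≤ i < j ≤ n-1, Γ⁺_I = ⟨τ_{i,j} | i,j ∈ I⟩,
-- and Γ⁺_I ∩ Γ⁺_J = Γ⁺_{I ∩ J} for all I, J ⊆ {0,…,n-1}.

tau : ∀ {n} → Fin n → Fin n → Word n
tau {n} i j =
  map (λ k → ⟨ false , k ⟩)
      (filterᵇ (λ k → (toℕ i ≤ᵇ toℕ k) ∧ (toℕ k <ᵇ toℕ j)) (allFin (n ∸ 1)))

TauGen : ∀ {n} → Subset n → Set
TauGen {n} I = Σ (Fin n × Fin n) (λ { (i , j) → i ∈ I × j ∈ I × toℕ i < toℕ j })

evalTau : ∀ {n} {I : Subset n} → List (Bool × TauGen I) → Word n
evalTau [] = []
evalTau ((b , (i , j) , _) ∷ ts) = (if b then inv (tau i j) else tau i j) ++ evalTau ts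

InΓ⁺ : ∀ {n} → (Word n → Set) → Subset n → Word n → Set
InΓ⁺ {n} M I g = ∃[ ts ] M (inv g ++ evalTau {n} {I} ts)

IntersectionCondition : ∀ n → (Word n → Set) → Set
IntersectionCondition n M =
  ∀ (I J : Subset n) (g : Word n) → InΓ⁺ M I g → InΓ⁺ M J g → InΓ⁺ M (I ∩ J) g

record FiniteChiralPolytope (n : ℕ) (M : Word n → Set) : Set where
  field
    kernel       : IsRotationKernel n M
    intersection : IntersectionCondition n M
    finite       : IsFinite (Γ⁺ n M)
    chiral       : ¬ SameSet (barSet M) M

-- The mix P ◇ Q has rotation group W⁺/N with N = M ∩ K;
-- it is chiral iff N̄ ≠ N.
MixKernel : ∀ {n} → (Word n → Set) → (Word n → Set) → Word n → Set
MixKernel M K w = M w × K w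

MixIsChiral : ∀ n → (Word n → Set) → (Word n → Set) → Set
MixIsChiral n M K = ¬ SameSet (barSet (MixKernel M K)) (MixKernel M K)

{-# OPTIONS --safe #-}
-- Suppose the mix is directly regular, i.e. N = M ∩ K satisfies N̄ = N.
-- Since Γ⁺(Q) = W⁺/K is simple, the images of the normal subgroups M and
-- M ∩ M̄ in W⁺/K are trivial or everything. If M ⊆ K then M = N = N̄ = M̄,
-- and if (M ∩ M̄)K = W⁺ then N̄ = N forces M ⊆ M̄; both contradict the
-- chirality of P. Hence MK = W⁺ and M ∩ M̄ ⊆ K, so M ∩ M̄ = M ∩ K and
--   X(P) = MM̄/M ≅ M̄/(M̄ ∩ M) ≅ M/(M ∩ M̄) = M/(M ∩ K) ≅ MK/K = Γ⁺(Q).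
module Submission where

open import Defs
open import Data.Bool using (true; false; not; if_then_else_)
open import Data.Bool.Properties using (not-involutive)
open import Data.Empty using (⊥-elim)
open import Data.Fin using (zero; suc)
open import Data.List using (List; []; _∷_; [_]; _++_; map; reverse; concatMap)
open import Data.List.Properties
  using (++-assoc; ++-identityʳ; map-++; map-∘; map-id; map-cong; reverse-++; reverse-map; reverse-involutive; unfold-reverse; concatMap-++)
open import Data.Nat using (ℕ; zero; suc)
open import Data.Product using (∃-syntax; _×_; _,_; proj₁; proj₂)
open import Data.Sum using (_⊎_; inj₁; inj₂)
open import Function using (_∘_; id)
open import Relation.Nullary using (¬_)
open import Relation.Binary.PropositionalEquality using (_≡_; refl; sym; trans; cong; cong₂; subst; module ≡-Reasoning)
open import Algebra.Morphism.Structures using (module GroupMorphisms)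

open ≡-Reasoning

flipL-involutive : ∀ {n} (x : Letter n) → flipL (flipL x) ≡ x
flipL-involutive ⟨ b , k ⟩ = cong ⟨_, k ⟩ (not-involutive b)

inv-++ : ∀ {n} (u v : Word n) → inv (u ++ v) ≡ inv v ++ inv u
inv-++ u v = trans (cong reverse (map-++ flipL u v)) (reverse-++ (map flipL u) (map flipL v))

inv-∷ : ∀ {n} (x : Letter n) (u : Word n) → inv (x ∷ u) ≡ inv u ++ [ flipL x ]
inv-∷ x u = unfold-reverse (flipL x) (map flipL u)

inv-involutive : ∀ {n} (u : Word n) → inv (inv u) ≡ u
inv-involutive u = begin
  reverse (map flipL (reverse (map flipL u))) ≡⟨ cong reverse (reverse-map flipL (map flipL u)) ⟩
  reverse (reverse (map flipL (map flipL u))) ≡⟨ reverse-involutive _ ⟩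
  map flipL (map flipL u)                     ≡⟨ map-∘ u ⟨
  map (flipL ∘ flipL) u                       ≡⟨ map-cong flipL-involutive u ⟩
  map id u                                    ≡⟨ map-id u ⟩
  u                                           ∎

inv-∷-split : ∀ {n} (u v w : Word n) (x : Letter n) →
  u ++ inv (x ∷ v) ++ x ∷ w ≡ (u ++ inv v) ++ flipL x ∷ flipL (flipL x) ∷ w
inv-∷-split u v w x = begin
  u ++ inv (x ∷ v) ++ x ∷ w                   ≡⟨ cong (λ z → u ++ z ++ x ∷ w) (inv-∷ x v) ⟩
  u ++ (inv v ++ [ flipL x ]) ++ x ∷ w        ≡⟨ cong (u ++_) (++-assoc (inv v) [ flipL x ] (x ∷ w)) ⟩
  u ++ inv v ++ flipL x ∷ x ∷ w               ≡⟨ ++-assoc u (inv v) _ ⟨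
  (u ++ inv v) ++ flipL x ∷ x ∷ w             ≡⟨ cong (λ y → (u ++ inv v) ++ flipL x ∷ y ∷ w) (flipL-involutive x) ⟨
  (u ++ inv v) ++ flipL x ∷ flipL (flipL x) ∷ w ∎

concatMap-reverse-map : ∀ {n} {A : Set} (f : A → Word n) (g : A → A) →
  (∀ x → f (g x) ≡ inv (f x)) → ∀ xs → concatMap f (reverse (map g xs)) ≡ inv (concatMap f xs)
concatMap-reverse-map f g f∘g≡inv∘f [] = refl
concatMap-reverse-map f g f∘g≡inv∘f (x ∷ xs) = begin
  concatMap f (reverse (map g (x ∷ xs)))            ≡⟨ cong (concatMap f) (unfold-reverse (g x) (map g xs)) ⟩
  concatMap f (reverse (map g xs) ++ [ g x ])       ≡⟨ concatMap-++ f (reverse (map g xs)) [ g x ] ⟩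
  concatMap f (reverse (map g xs)) ++ f (g x) ++ [] ≡⟨ cong₂ _++_ (concatMap-reverse-map f g f∘g≡inv∘f xs)
                                                                  (trans (++-identityʳ _) (f∘g≡inv∘f x)) ⟩
  inv (concatMap f xs) ++ inv (f x)                 ≡⟨ inv-++ (f x) (concatMap f xs) ⟨
  inv (concatMap f (x ∷ xs))                        ∎

bar-++ : ∀ {n} (u v : Word n) → bar (u ++ v) ≡ bar u ++ bar v
bar-++ = concatMap-++ barLetter

barLetter-flipL : ∀ {n} (x : Letter n) → barLetter (flipL x) ≡ inv (barLetter x)
barLetter-flipL {zero}  ⟨ b     , () ⟩
barLetter-flipL {suc m} ⟨ b     , zero ⟩          = refl
barLetter-flipL {suc m} ⟨ false , suc zero ⟩      = refl
barLetter-flipL {suc m} ⟨ true  , suc zero ⟩      = refl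
barLetter-flipL {suc m} ⟨ false , suc (suc k) ⟩   = refl
barLetter-flipL {suc m} ⟨ true  , suc (suc k) ⟩   = refl

bar-inv : ∀ {n} (u : Word n) → bar (inv u) ≡ inv (bar u)
bar-inv = concatMap-reverse-map barLetter flipL barLetter-flipL

bar-inv-++ : ∀ {n} (u v : Word n) → bar (inv u ++ v) ≡ inv (bar u) ++ bar v
bar-inv-++ u v = trans (bar-++ (inv u) v) (cong (_++ bar v) (bar-inv u))

record IsNormalWordSet {n} (R : Word n → Set) : Set where
  field
    ε-mem     : R []
    ∙-closed  : ∀ u v → R u → R v → R (u ++ v)
    ⁻¹-closed : ∀ u → R u → R (inv u)
    normal    : ∀ w u → R u → R (w ++ u ++ inv w)

kernel-isNormalWordSet : ∀ {n} {M : Word n → Set} → IsRotationKernel n M → IsNormalWordSet M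
kernel-isNormalWordSet M-kernel = record { IsRotationKernel M-kernel }

∩-isNormalWordSet : ∀ {n} {R S : Word n → Set} →
  IsNormalWordSet R → IsNormalWordSet S → IsNormalWordSet (λ w → R w × S w)
∩-isNormalWordSet R-normal S-normal = record
  { ε-mem     = R.ε-mem , S.ε-mem
  ; ∙-closed  = λ u v (ru , su) (rv , sv) → R.∙-closed u v ru rv , S.∙-closed u v su sv
  ; ⁻¹-closed = λ u (ru , su) → R.⁻¹-closed u ru , S.⁻¹-closed u su
  ; normal    = λ w u (ru , su) → R.normal w u ru , S.normal w u su
  }
  where
  module R = IsNormalWordSet R-normal
  module S = IsNormalWordSet S-normal

barSet-isNormalWordSet : ∀ {n} {R : Word n → Set} → IsNormalWordSet R → IsNormalWordSet (barSet R)
barSet-isNormalWordSet {R = R} R-normal = record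
  { ε-mem     = ε-mem
  ; ∙-closed  = λ u v ru rv → subst R (sym (bar-++ u v)) (∙-closed _ _ ru rv)
  ; ⁻¹-closed = λ u ru → subst R (sym (bar-inv u)) (⁻¹-closed _ ru)
  ; normal    = λ w u ru → subst R (sym (bar-conjugate w u)) (normal (bar w) (bar u) ru)
  }
  where
  open IsNormalWordSet R-normal
  bar-conjugate : ∀ w u → bar (w ++ u ++ inv w) ≡ bar w ++ bar u ++ inv (bar w)
  bar-conjugate w u = begin
    bar (w ++ u ++ inv w)             ≡⟨ bar-++ w (u ++ inv w) ⟩
    bar w ++ bar (u ++ inv w)         ≡⟨ cong (bar w ++_) (bar-++ u (inv w)) ⟩
    bar w ++ bar u ++ bar (inv w)     ≡⟨ cong (λ z → bar w ++ bar u ++ z) (bar-inv w) ⟩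
    bar w ++ bar u ++ inv (bar w)     ∎

module KernelProperties {n} {M : Word n → Set} (M-kernel : IsRotationKernel n M) where
  open IsRotationKernel M-kernel

  -- A record rather than M (inv u ++ v) itself, so that u and v can be inferred.
  infix 4 _≈_
  record _≈_ (u v : Word n) : Set where
    constructor ⟪_⟫
    field mem : M (inv u ++ v)
  open _≈_ public

  insert-inverse : ∀ u v w → M (u ++ w) → M (u ++ inv v ++ v ++ w)
  insert-inverse u []      w m = m
  insert-inverse u (x ∷ v) w m =
    subst M (sym (inv-∷-split u v (v ++ w) x))
      (unreduce (u ++ inv v) (flipL x) (v ++ w)
        (subst M (sym (++-assoc u (inv v) (v ++ w))) (insert-inverse u v w m)))

  cancel-inverse : ∀ u v w → M (u ++ inv v ++ v ++ w) → M (u ++ w)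
  cancel-inverse u []      w m = m
  cancel-inverse u (x ∷ v) w m =
    cancel-inverse u v w
      (subst M (++-assoc u (inv v) (v ++ w))
        (reduce (u ++ inv v) (flipL x) (v ++ w) (subst M (inv-∷-split u v (v ++ w) x) m)))

  cancel-inverseʳ : ∀ u v w → M (u ++ v ++ inv v ++ w) → M (u ++ w)
  cancel-inverseʳ u v w m =
    cancel-inverse u (inv v) w (subst (λ z → M (u ++ z ++ inv v ++ w)) (sym (inv-involutive v)) m)

  ≈-refl : ∀ {u} → u ≈ u
  ≈-refl {u} = ⟪ subst M (cong (inv u ++_) (++-identityʳ u)) (insert-inverse [] u [] ε-mem) ⟫

  ≈-reflexive : ∀ {u v} → u ≡ v → u ≈ v
  ≈-reflexive refl = ≈-refl

  ≈-sym : ∀ {u v} → u ≈ v → v ≈ u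
  ≈-sym {u} {v} ⟪ m ⟫ =
    ⟪ subst M (trans (inv-++ (inv u) v) (cong (inv v ++_) (inv-involutive u))) (⁻¹-closed _ m) ⟫

  ≈-trans : ∀ {u v w} → u ≈ v → v ≈ w → u ≈ w
  ≈-trans {u} {v} {w} ⟪ p ⟫ ⟪ q ⟫ =
    ⟪ cancel-inverseʳ (inv u) v w (subst M (++-assoc (inv u) v (inv v ++ w)) (∙-closed _ _ p q)) ⟫

  ∙-congʳ : ∀ {u v} w → u ≈ v → u ++ w ≈ v ++ w
  ∙-congʳ {u} {v} w ⟪ m ⟫ = ⟪ subst M eq (normal (inv w) (inv u ++ v) m) ⟫
    where
    eq : inv w ++ (inv u ++ v) ++ inv (inv w) ≡ inv (u ++ w) ++ v ++ w
    eq = begin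
      inv w ++ (inv u ++ v) ++ inv (inv w) ≡⟨ cong (λ z → inv w ++ (inv u ++ v) ++ z) (inv-involutive w) ⟩
      inv w ++ (inv u ++ v) ++ w           ≡⟨ cong (inv w ++_) (++-assoc (inv u) v w) ⟩
      inv w ++ inv u ++ v ++ w             ≡⟨ ++-assoc (inv w) (inv u) (v ++ w) ⟨
      (inv w ++ inv u) ++ v ++ w           ≡⟨ cong (_++ v ++ w) (inv-++ u w) ⟨
      inv (u ++ w) ++ v ++ w               ∎

  ∙-congˡ : ∀ u {v w} → v ≈ w → u ++ v ≈ u ++ w
  ∙-congˡ u {v} {w} ⟪ m ⟫ = ⟪ subst M eq (insert-inverse (inv v) u w m) ⟫
    where
    eq : inv v ++ inv u ++ u ++ w ≡ inv (u ++ v) ++ u ++ w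
    eq = trans (sym (++-assoc (inv v) (inv u) (u ++ w))) (cong (_++ u ++ w) (sym (inv-++ u v)))

  ∙-cong : ∀ {u v w x} → u ≈ v → w ≈ x → u ++ w ≈ v ++ x
  ∙-cong {v = v} {w} u≈v w≈x = ≈-trans (∙-congʳ w u≈v) (∙-congˡ v w≈x)

  ⁻¹-cong : ∀ {u v} → u ≈ v → inv u ≈ inv v
  ⁻¹-cong {u} {v} u≈v = ⟪ subst M (cong (_++ inv v) (sym (inv-involutive u))) (cancel-inverseʳ [] v (u ++ inv v) conjugate) ⟫
    where
    conjugate : M (v ++ inv v ++ u ++ inv v)
    conjugate = subst (λ z → M (v ++ z)) (++-assoc (inv v) u (inv v)) (normal v (inv v ++ u) (≈-sym u≈v .mem))

  mem⇒≈ε : ∀ {u} → M u → u ≈ []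
  mem⇒≈ε m = ≈-sym ⟪ m ⟫

  ≈ε⇒mem : ∀ {u} → u ≈ [] → M u
  ≈ε⇒mem u≈ε = ≈-sym u≈ε .mem

  mem-resp-≈ : ∀ {u v} → u ≈ v → M u → M v
  mem-resp-≈ u≈v m = ≈ε⇒mem (≈-trans (≈-sym u≈v) (mem⇒≈ε m))

  reduction : ∀ u x v → u ++ x ∷ flipL x ∷ v ≈ u ++ v
  reduction u x v = ∙-congˡ u (∙-congʳ v (mem⇒≈ε (unreduce [] x [] ε-mem)))

  signed-mem : ∀ b {w} → M w → M (if b then inv w else w)
  signed-mem false m = m
  signed-mem true  m = ⁻¹-closed _ m

-- bar ∘ bar is the identity only up to free cancellation: σ₂ ↦ σ₁²σ₂ ↦ σ₁⁻¹σ₁⁻¹σ₁σ₁σ₂.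
bar-barLetter : ∀ {n} {M : Word n → Set} (M-kernel : IsRotationKernel n M) (x : Letter n) →
  KernelProperties._≈_ M-kernel (bar (barLetter x)) [ x ]
bar-barLetter {zero}  M-kernel ⟨ b , () ⟩
bar-barLetter {suc m} M-kernel ⟨ b , zero ⟩ =
  KernelProperties.≈-reflexive M-kernel (cong (λ c → [ ⟨ c , zero ⟩ ]) (not-involutive b))
bar-barLetter {suc m} M-kernel ⟨ false , suc zero ⟩ =
  ≈-trans (reduction [ ⟨ true , zero ⟩ ] ⟨ true , zero ⟩ (⟨ false , zero ⟩ ∷ [ ⟨ false , suc zero ⟩ ]))
          (reduction [] ⟨ true , zero ⟩ [ ⟨ false , suc zero ⟩ ])
  where open KernelProperties M-kernel
bar-barLetter {suc m} M-kernel ⟨ true , suc zero ⟩ =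
  ≈-trans (reduction (⟨ true , suc zero ⟩ ∷ [ ⟨ true , zero ⟩ ]) ⟨ true , zero ⟩ [ ⟨ false , zero ⟩ ])
          (reduction [ ⟨ true , suc zero ⟩ ] ⟨ true , zero ⟩ [])
  where open KernelProperties M-kernel
bar-barLetter {suc m} M-kernel ⟨ false , suc (suc k) ⟩ = KernelProperties.≈-refl M-kernel
bar-barLetter {suc m} M-kernel ⟨ true  , suc (suc k) ⟩ = KernelProperties.≈-refl M-kernel

bar-involutive : ∀ {n} {M : Word n → Set} (M-kernel : IsRotationKernel n M) (u : Word n) →
  KernelProperties._≈_ M-kernel (bar (bar u)) u
bar-involutive M-kernel []      = KernelProperties.≈-refl M-kernel
bar-involutive M-kernel (x ∷ u) =
  ≈-trans (≈-reflexive (bar-++ (barLetter x) (bar u))) (∙-cong (bar-barLetter M-kernel x) (bar-involutive M-kernel u))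
  where open KernelProperties M-kernel

Image : ∀ {n} → (Word n → Set) → (Word n → Set) → Word n → Set
Image K R g = ∃[ r ] R r × K (inv r ++ g)

image-isNormalSubgroup : ∀ {n} {K R : Word n → Set} →
  IsRotationKernel n K → IsNormalWordSet R → IsNormalSubgroup (Γ⁺ n K) (Image K R)
image-isNormalSubgroup {K = K} {R} K-kernel R-normal =
    (λ { {h} {g} h≈g (r , rr , r≈h) → r , rr , ≈-trans {r} {h} {g} ⟪ r≈h ⟫ ⟪ h≈g ⟫ .mem })
  , ([] , ε-mem , IsRotationKernel.ε-mem K-kernel)
  , (λ { g h (r , rr , r≈g) (s , rs , s≈h) → r ++ s , ∙-closed r s rr rs , ∙-cong {r} {g} {s} {h} ⟪ r≈g ⟫ ⟪ s≈h ⟫ .mem })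
  , (λ { g (r , rr , r≈g) → inv r , ⁻¹-closed r rr , ⁻¹-cong {r} {g} ⟪ r≈g ⟫ .mem })
  , (λ { g h (r , rr , r≈h) → (g ++ r) ++ inv g
                             , subst R (sym (++-assoc g r (inv g))) (normal g r rr)
                             , ∙-congʳ (inv g) (∙-congˡ g {r} {h} ⟪ r≈h ⟫) .mem })
  where
  open IsNormalWordSet R-normal
  open KernelProperties K-kernel

simple⇒⊆⊎covers : ∀ {n} {K R : Word n → Set} → IsRotationKernel n K → IsSimple (Γ⁺ n K) →
  IsNormalWordSet R → (∀ w → R w → K w) ⊎ (∀ g → Image K R g)
simple⇒⊆⊎covers {K = K} {R} K-kernel (_ , trivial⊎everything) R-normal
  with trivial⊎everything (Image K R) (image-isNormalSubgroup K-kernel R-normal)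
... | inj₁ trivial = inj₁ λ w rw → ≈ε⇒mem ⟪ trivial w (w , rw , ≈-refl {w} .mem) ⟫
  where open KernelProperties K-kernel
... | inj₂ covers = inj₂ covers

bar-closed⇒barSet-same : ∀ {n} {M : Word n → Set} → IsRotationKernel n M →
  (∀ w → M w → M (bar w)) → SameSet (barSet M) M
bar-closed⇒barSet-same M-kernel bar-closed w =
  (λ m̄ → mem-resp-≈ (bar-involutive M-kernel w) (bar-closed (bar w) m̄)) , bar-closed w
  where open KernelProperties M-kernel

covered-by-M∩M̄⇒bar-closed : ∀ {n} {M K : Word n → Set} → IsRotationKernel n M →
  (∀ w → M w → K w → M (bar w)) → (∀ g → Image K (λ w → M w × M (bar w)) g) →
  ∀ x → M x → M (bar x)
covered-by-M∩M̄⇒bar-closed {M = M} M-kernel M∩K⊆M̄ covers x mx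
  with covers x
... | m , (mm , mm̄) , k = cancel-inverseʳ [] (bar m) (bar x) (∙-closed _ _ mm̄ barred-quotient)
  where
  open IsRotationKernel M-kernel
  open KernelProperties M-kernel
  barred-quotient : M (inv (bar m) ++ bar x)
  barred-quotient = subst M (bar-inv-++ m x) (M∩K⊆M̄ _ (∙-closed _ _ (⁻¹-closed m mm) mx) k)

-- φ kills the factors from M and applies bar to those from M̄, landing in M.
φ₁ : ∀ {n M} → Piece n M → Word n
φ₁ (b , w , inj₁ _) = []
φ₁ (b , w , inj₂ _) = bar (if b then inv w else w)

φ : ∀ {n M} → List (Piece n M) → Word n
φ = concatMap φ₁

φ₁-flip : ∀ {n M} b w (m : M w ⊎ M (bar w)) → φ₁ {n} {M} (not b , w , m) ≡ inv (φ₁ {n} {M} (b , w , m))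
φ₁-flip b     w (inj₁ _) = refl
φ₁-flip false w (inj₂ _) = bar-inv w
φ₁-flip true  w (inj₂ _) = sym (trans (cong inv (bar-inv w)) (inv-involutive (bar w)))

φ-invPieces : ∀ {n M} (ps : List (Piece n M)) → φ (invPieces ps) ≡ inv (φ ps)
φ-invPieces {n} {M} = concatMap-reverse-map φ₁ _ λ { (b , w , m) → φ₁-flip {n} {M} b w m }

module _ {n} {M : Word n → Set} (M-kernel : IsRotationKernel n M) where
  open IsRotationKernel M-kernel
  open KernelProperties M-kernel

  φ-mem : ∀ (ps : List (Piece n M)) → M (φ ps)
  φ-mem []                          = ε-mem
  φ-mem ((b , w , inj₁ _) ∷ ps)     = φ-mem ps
  φ-mem ((false , w , inj₂ m̄) ∷ ps) = ∙-closed _ _ m̄ (φ-mem ps)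
  φ-mem ((true  , w , inj₂ m̄) ∷ ps) = ∙-closed _ _ (subst M (sym (bar-inv w)) (⁻¹-closed _ m̄)) (φ-mem ps)

  evalPieces≈bar∘φ : ∀ (ps : List (Piece n M)) → evalPieces ps ≈ bar (φ ps)
  evalPieces≈bar∘φ []                      = ≈-refl
  evalPieces≈bar∘φ ((b , w , inj₁ m) ∷ ps) =
    ≈-trans (∙-congʳ (evalPieces ps) (mem⇒≈ε (signed-mem b m))) (evalPieces≈bar∘φ ps)
  evalPieces≈bar∘φ ((b , w , inj₂ _) ∷ ps) =
    ≈-trans (∙-cong (≈-sym (bar-involutive M-kernel _)) (evalPieces≈bar∘φ ps))
            (≈-reflexive (sym (bar-++ (bar (if b then inv w else w)) (φ ps))))

X≅Γ⁺ : ∀ {n} {M K : Word n → Set} → IsRotationKernel n M → IsRotationKernel n K →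
  (∀ w → M w → M (bar w) → K w) → (∀ w → M w → K w → M (bar w)) → (∀ g → Image K M g) →
  Isomorphic (X n M) (Γ⁺ n K)
X≅Γ⁺ {n} {M} {K} M-kernel K-kernel M∩M̄⊆K M∩K⊆M̄ M-covers = φ , record
  { isGroupMonomorphism = record
    { isGroupHomomorphism = record
      { isMonoidHomomorphism = record
        { isMagmaHomomorphism = record
          { isRelHomomorphism = record { cong = λ {p} {q} p≈q → φ-cong p q M.⟪ p≈q ⟫ .K.mem }
          ; homo = λ p q → K.≈-reflexive (concatMap-++ φ₁ p q) .K.mem
          }
        ; ε-homo = IsRotationKernel.ε-mem K-kernel
        }
      ; ⁻¹-homo = λ p → K.≈-reflexive (φ-invPieces p) .K.mem
      }
    ; injective = λ {p} {q} φ≈ → φ-injective p q K.⟪ φ≈ ⟫ .M.mem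
    }
  ; surjective = φ-surjective
  }
  where
  module M = KernelProperties M-kernel
  module K = KernelProperties K-kernel
  open IsRotationKernel M-kernel using (∙-closed; ⁻¹-closed)

  quotient-mem : ∀ p q → M (inv (φ p) ++ φ q)
  quotient-mem p q = ∙-closed _ _ (⁻¹-closed _ (φ-mem M-kernel p)) (φ-mem M-kernel q)

  φ-cong : ∀ p q → evalPieces p M.≈ evalPieces q → φ p K.≈ φ q
  φ-cong p q p≈q = K.⟪ M∩M̄⊆K _ (quotient-mem p q) (subst M (sym (bar-inv-++ (φ p) (φ q))) (bar-φ≈ .M.mem)) ⟫
    where
    bar-φ≈ : bar (φ p) M.≈ bar (φ q)
    bar-φ≈ = M.≈-trans (M.≈-sym (evalPieces≈bar∘φ M-kernel p)) (M.≈-trans p≈q (evalPieces≈bar∘φ M-kernel q))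

  φ-injective : ∀ p q → φ p K.≈ φ q → evalPieces p M.≈ evalPieces q
  φ-injective p q φ≈ =
    M.≈-trans (evalPieces≈bar∘φ M-kernel p) (M.≈-trans bar-φ≈ (M.≈-sym (evalPieces≈bar∘φ M-kernel q)))
    where
    bar-φ≈ : bar (φ p) M.≈ bar (φ q)
    bar-φ≈ = M.⟪ subst M (bar-inv-++ (φ p) (φ q)) (M∩K⊆M̄ _ (quotient-mem p q) (φ≈ .K.mem)) ⟫

  φ-surjective : ∀ g → ∃[ ps ] (∀ {qs} → M (inv (evalPieces qs) ++ evalPieces ps) → K (inv (φ qs) ++ g))
  φ-surjective g with M-covers g
  ... | m , mm , m≈g = preimage , λ {qs} qs≈ →
      K.≈-trans (φ-cong qs preimage M.⟪ qs≈ ⟫)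
        (K.≈-trans (K.≈-reflexive (++-identityʳ _)) (K.≈-trans (bar-involutive K-kernel m) K.⟪ m≈g ⟫)) .K.mem
    where
    preimage : List (Piece n M)
    preimage = [ false , bar m , inj₂ (M.mem-resp-≈ (M.≈-sym (bar-involutive M-kernel m)) mm) ]

theorem4p7 : (n : ℕ) (M K : Word n → Set)
    → FiniteChiralPolytope n M
    → FiniteChiralPolytope n K
    → IsSimple (Γ⁺ n K)
    → ¬ Isomorphic (X n M) (Γ⁺ n K)
    → MixIsChiral n M K
theorem4p7 n M K P Q Γ⁺-simple X≇Γ⁺ N̄≐N = X≇Γ⁺ (X≅Γ⁺ M-kernel K-kernel M∩M̄⊆K M∩K⊆M̄ M-covers)
  where
  open FiniteChiralPolytope P using (chiral) renaming (kernel to M-kernel)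
  open FiniteChiralPolytope Q using () renaming (kernel to K-kernel)

  M∩K⊆M̄ : ∀ w → M w → K w → M (bar w)
  M∩K⊆M̄ w m k = proj₁ (proj₂ (N̄≐N w) (m , k))

  M-normal : IsNormalWordSet M
  M-normal = kernel-isNormalWordSet M-kernel

  not-bar-closed : ¬ (∀ w → M w → M (bar w))
  not-bar-closed = chiral ∘ bar-closed⇒barSet-same M-kernel

  M∩M̄⊆K : ∀ w → M w → M (bar w) → K w
  M∩M̄⊆K with simple⇒⊆⊎covers K-kernel Γ⁺-simple (∩-isNormalWordSet M-normal (barSet-isNormalWordSet M-normal))
  ... | inj₁ ⊆K     = λ w m m̄ → ⊆K w (m , m̄)
  ... | inj₂ covers = ⊥-elim (not-bar-closed (covered-by-M∩M̄⇒bar-closed M-kernel M∩K⊆M̄ covers))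

  M-covers : ∀ g → Image K M g
  M-covers with simple⇒⊆⊎covers K-kernel Γ⁺-simple M-normal
  ... | inj₁ M⊆K    = ⊥-elim (not-bar-closed λ w m → M∩K⊆M̄ w m (M⊆K w m))
  ... | inj₂ covers = covers
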